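{- Let $G$ be a connected stepwise irregular graph. Then for every edge $e$ of $G$, the graph $G-e$ is not stepwise irregular.
   Context: All graphs are finite and simple. A graph $G$ is stepwise irregular (SI) if for every edge $uv\in E(G)$ one has $|d_G(u)-d_G(v)|=1$, where $d_G$ denotes degree; a disconnected graph is called SI if each of its connected components is SI. $G-e$ denotes the graph obtained from $G$ by deleting the edge $e$ (keeping all vertices). -}

module Defs where

open import Data.Nat using (ℕ; zero; suc; _+_; ∣_-_∣)
open import Data.Fin using (Fin; zero; suc)
open import Data.Fin.Properties using (_≟_)
open import Data.Bool using (Bool; true; false; _∧_; not; T)
open import Data.Sum using (_⊎_)
open import Data.Product using (_×_)
open import Relation.Binary.PropositionalEquality using (_≡_)
open import Relation.Nullary.Decidable using (⌊_⌋)

record Graph (n : ℕ) : Set where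
  field
    adj     : Fin n → Fin n → Bool
    sym     : ∀ u v → adj u v ≡ adj v u
    irrefl  : ∀ v → adj v v ≡ false
open Graph public

sumFin : (n : ℕ) → (Fin n → ℕ) → ℕ
sumFin zero    f = 0
sumFin (suc n) f = f zero + sumFin n (λ i → f (suc i))

b2n : Bool → ℕ
b2n true  = 1
b2n false = 0

deg : ∀ {n} → Graph n → Fin n → ℕ
deg {n} G v = sumFin n (λ w → b2n (adj G v w))

Edge : ∀ {n} → Graph n → Fin n → Fin n → Set
Edge G u v = adj G u v ≡ true

data Walk {n} (G : Graph n) : Fin n → Fin n → Set where
  here : ∀ {v} → Walk G v v
  step : ∀ {u v w} → Edge G u v → Walk G v w → Walk G u w

Connected : ∀ {n} → Graph n → Set
Connected {n} G = ∀ (u v : Fin n) → Walk G u v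

-- stepwise irregular: every edge uv has |d(u) - d(v)| = 1.
-- (For a disconnected graph this is the same as every component being SI,
-- since degrees are computed within the component.)
StepwiseIrregular : ∀ {n} → Graph n → Set
StepwiseIrregular G = ∀ u v → Edge G u v → ∣ deg G u - deg G v ∣ ≡ 1

samePair : ∀ {n} → Fin n → Fin n → Fin n → Fin n → Bool
samePair u v x y =
  (⌊ x ≟ u ⌋ ∧ ⌊ y ≟ v ⌋) Data.Bool.∨ (⌊ x ≟ v ⌋ ∧ ⌊ y ≟ u ⌋)

private
  ∧-false : ∀ b → (b ∧ false) ≡ false
  ∧-false true  = _≡_.refl
  ∧-false false = _≡_.refl

  ∨-comm : ∀ a b → (a Data.Bool.∨ b) ≡ (b Data.Bool.∨ a)
  ∨-comm true true = _≡_.refl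
  ∨-comm true false = _≡_.refl
  ∨-comm false true = _≡_.refl
  ∨-comm false false = _≡_.refl

open import Relation.Binary.PropositionalEquality using (cong₂; cong; refl)

samePair-sym : ∀ {n} (u v x y : Fin n) → samePair u v x y ≡ samePair u v y x
samePair-sym u v x y = ∨-comm-like (⌊ x ≟ u ⌋) (⌊ y ≟ v ⌋) (⌊ x ≟ v ⌋) (⌊ y ≟ u ⌋)
  where
  ∨-comm-like : ∀ a b c d → ((a ∧ b) Data.Bool.∨ (c ∧ d)) ≡ ((d ∧ c) Data.Bool.∨ (b ∧ a))
  ∨-comm-like true  true  true  true  = refl
  ∨-comm-like true  true  true  false = refl
  ∨-comm-like true  true  false true  = refl
  ∨-comm-like true  true  false false = refl
  ∨-comm-like true  false c     d     = lem c d
    where lem : ∀ c d → (false Data.Bool.∨ (c ∧ d)) ≡ ((d ∧ c) Data.Bool.∨ false)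
          lem true true = refl
          lem true false = refl
          lem false true = refl
          lem false false = refl
  ∨-comm-like false b c d = lem b c d
    where lem : ∀ b c d → (false Data.Bool.∨ (c ∧ d)) ≡ ((d ∧ c) Data.Bool.∨ (b ∧ false))
          lem b true true = refl
          lem true true false = refl
          lem false true false = refl
          lem true false true = refl
          lem false false true = refl
          lem true false false = refl
          lem false false false = refl

deleteEdge : ∀ {n} → Graph n → Fin n → Fin n → Graph n
deleteEdge {n} G u v = record
  { adj    = λ x y → adj G x y ∧ not (samePair u v x y)
  ; sym    = λ x y → cong₂ _∧_ (Graph.sym G x y) (cong not (samePair-sym u v x y))
  ; irrefl = λ x → cong (λ b → b ∧ not (samePair u v x x)) (irrefl G x)
  }

module Submission where

-- Deleting an edge uv from a stepwise irregular (SI) graph G never leaves an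
-- SI graph.
--
-- In G' = G - uv the endpoints lose one degree each and every other vertex
-- keeps its degree.  Suppose G' is SI.  If u still had a neighbour w in G',
-- then w ∉ {u, v}, so d_G'(w) = d_G(w), and both
--   |d_G'(u) - d_G(w)| = 1   and   |d_G'(u) + 1 - d_G(w)| = 1,
-- which is impossible since the two differences have different parity.
-- Hence u is isolated in G' and d_G(u) = 1; by symmetry d_G(v) = 1, and then
-- the edge uv of G violates |d_G(u) - d_G(v)| = 1.

open import Defs hiding (sym)
open import Data.Nat using (ℕ; zero; suc; _+_; ∣_-_∣)
open import Data.Nat.Properties using (+-suc; ∣n-n∣≡0) renaming (_≟_ to _≟ℕ_)
open import Data.Fin using (Fin; zero; suc)
open import Data.Fin.Properties using (_≟_; suc-injective)
open import Data.Bool using (Bool; true; false; _∧_; not)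
open import Data.Bool.Properties using (∧-identityʳ; ∧-zeroʳ; ∨-comm)
open import Data.Product using (Σ; _×_; _,_)
open import Data.Empty using (⊥-elim)
open import Relation.Nullary using (¬_; yes; no)
open import Relation.Nullary.Decidable using (⌊_⌋)
open import Relation.Binary.PropositionalEquality
  using (_≡_; _≢_; refl; sym; trans; cong; cong₂; subst)
open Relation.Binary.PropositionalEquality.≡-Reasoning

count : (n : ℕ) → (Fin n → Bool) → ℕ
count n f = sumFin n (λ i → b2n (f i))

sumFin-cong : ∀ n {f g : Fin n → ℕ} → (∀ i → f i ≡ g i) → sumFin n f ≡ sumFin n g
sumFin-cong zero    f≗g = refl
sumFin-cong (suc n) f≗g = cong₂ _+_ (f≗g zero) (sumFin-cong n (λ i → f≗g (suc i)))

count-witness : ∀ n (f : Fin n → Bool) → count n f ≢ 0 → Σ (Fin n) (λ i → f i ≡ true)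
count-witness zero    f nonzero = ⊥-elim (nonzero refl)
count-witness (suc n) f nonzero with f zero in f0
... | true  = zero , f0
... | false with count-witness n (λ i → f (suc i)) nonzero
...   | i , fi = suc i , fi

count-switch-off : ∀ n (f g : Fin n → Bool) (y : Fin n) → f y ≡ true → g y ≡ false →
  (∀ i → i ≢ y → g i ≡ f i) → suc (count n g) ≡ count n f
count-switch-off (suc n) f g zero fy gy agree rewrite fy | gy =
  cong suc (sumFin-cong n (λ i → cong b2n (agree (suc i) λ ())))
count-switch-off (suc n) f g (suc y) fy gy agree rewrite agree zero (λ ()) = begin
  suc (b2n (f zero) + count n (λ i → g (suc i)))  ≡⟨ sym (+-suc (b2n (f zero)) _) ⟩
  b2n (f zero) + suc (count n (λ i → g (suc i)))  ≡⟨ cong (b2n (f zero) +_) rest ⟩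
  b2n (f zero) + count n (λ i → f (suc i))        ∎
  where
  rest : suc (count n (λ i → g (suc i))) ≡ count n (λ i → f (suc i))
  rest = count-switch-off n (λ i → f (suc i)) (λ i → g (suc i)) y fy gy
           (λ i i≢y → agree (suc i) (λ eq → i≢y (suc-injective eq)))

-- Two numbers whose distances to c are both 1 cannot be consecutive
-- (a and a + 1 lie on different sides of c only if one of them equals c).
unit-distances-not-consecutive : ∀ a c → ∣ a - c ∣ ≡ 1 → ∣ suc a - c ∣ ≢ 1
unit-distances-not-consecutive zero          (suc zero)    _ ()
unit-distances-not-consecutive (suc zero)    zero          _ ()
unit-distances-not-consecutive (suc a)       (suc c)       p q =
  unit-distances-not-consecutive a c p q
unit-distances-not-consecutive zero          zero          () _
unit-distances-not-consecutive zero          (suc (suc c)) () _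
unit-distances-not-consecutive (suc (suc a)) zero          () _

∧-trueˡ : ∀ a b → a ∧ b ≡ true → a ≡ true
∧-trueˡ true _ _ = refl

edge-distinct : ∀ {n} (G : Graph n) {x y} → Edge G x y → x ≢ y
edge-distinct G {x} e refl with trans (sym e) (irrefl G x)
... | ()

edge-sym : ∀ {n} (G : Graph n) {x y} → Edge G x y → Edge G y x
edge-sym G {x} {y} e = trans (Graph.sym G y x) e

si-cong : ∀ {n} (H K : Graph n) → (∀ x y → adj H x y ≡ adj K x y) →
  StepwiseIrregular H → StepwiseIrregular K
si-cong {n} H K same siH x y e =
  subst (λ d → d ≡ 1) (cong₂ ∣_-_∣ (deg-same x) (deg-same y))
        (siH x y (trans (same x y) e))
  where
  deg-same : ∀ z → deg H z ≡ deg K z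
  deg-same z = sumFin-cong n (λ w → cong b2n (same z w))

samePair-refl : ∀ {n} (u v : Fin n) → samePair u v u v ≡ true
samePair-refl u v with u ≟ u | v ≟ v
... | yes _  | yes _  = refl
... | no u≢u | _      = ⊥-elim (u≢u refl)
... | _      | no v≢v = ⊥-elim (v≢v refl)

samePair-false : ∀ {n} {u v x y : Fin n} →
  ¬ (x ≡ u × y ≡ v) → ¬ (x ≡ v × y ≡ u) → samePair u v x y ≡ false
samePair-false {u = u} {v} {x} {y} ≠uv ≠vu with x ≟ u | y ≟ v | x ≟ v | y ≟ u
... | yes p | yes q | _     | _     = ⊥-elim (≠uv (p , q))
... | _     | _     | yes p | yes q = ⊥-elim (≠vu (p , q))
... | no _  | _     | no _  | _     = refl
... | no _  | _     | yes _ | no _  = refl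
... | yes _ | no _  | no _  | _     = refl
... | yes _ | no _  | yes _ | no _  = refl

deleteEdge-comm : ∀ {n} (G : Graph n) (u v : Fin n) →
  ∀ x y → adj (deleteEdge G u v) x y ≡ adj (deleteEdge G v u) x y
deleteEdge-comm G u v x y =
  cong (λ b → adj G x y ∧ not b) (∨-comm (⌊ x ≟ u ⌋ ∧ ⌊ y ≟ v ⌋) (⌊ x ≟ v ⌋ ∧ ⌊ y ≟ u ⌋))

deleteEdge-removes : ∀ {n} (G : Graph n) (u v : Fin n) → adj (deleteEdge G u v) u v ≡ false
deleteEdge-removes G u v rewrite samePair-refl u v = ∧-zeroʳ (adj G u v)

deleteEdge-keeps : ∀ {n} (G : Graph n) {u v x y : Fin n} → samePair u v x y ≡ false →
  adj (deleteEdge G u v) x y ≡ adj G x y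
deleteEdge-keeps G {x = x} {y} different rewrite different = ∧-identityʳ (adj G x y)

module DeleteEdge {n} (G : Graph n) {u v : Fin n} (e : Edge G u v) where

  G' : Graph n
  G' = deleteEdge G u v

  endpoint-degree : deg G u ≡ suc (deg G' u)
  endpoint-degree = sym (count-switch-off n (adj G u) (adj G' u) v e
    (deleteEdge-removes G u v)
    (λ w w≢v → deleteEdge-keeps G
      (samePair-false (λ { (_ , w≡v) → w≢v w≡v })
                      (λ { (u≡v , _) → edge-distinct G e u≡v }))))

  other-degree : ∀ w → w ≢ u → w ≢ v → deg G' w ≡ deg G w
  other-degree w w≢u w≢v = sumFin-cong n (λ z → cong b2n
    (deleteEdge-keeps G (samePair-false (λ { (w≡u , _) → w≢u w≡u })
                                        (λ { (w≡v , _) → w≢v w≡v }))))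

  -- Key lemma: if both G and G' are SI, then u is isolated in G'.  A surviving
  -- neighbour w would be at degree distance 1 from both d_G'(u) and d_G'(u)+1.
  endpoint-isolated : StepwiseIrregular G → StepwiseIrregular G' → deg G' u ≡ 0
  endpoint-isolated si si' with deg G' u ≟ℕ 0
  ... | yes isolated = isolated
  ... | no nonisolated with count-witness n (adj G' u) nonisolated
  ...   | w , e' = ⊥-elim (unit-distances-not-consecutive (deg G' u) (deg G w) in-G' in-G)
    where
    e-uw : Edge G u w
    e-uw = ∧-trueˡ (adj G u w) _ e'

    w≢v : w ≢ v
    w≢v refl with trans (sym e') (deleteEdge-removes G u v)
    ... | ()

    in-G' : ∣ deg G' u - deg G w ∣ ≡ 1
    in-G' = subst (λ d → ∣ deg G' u - d ∣ ≡ 1)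
              (other-degree w (λ w≡u → edge-distinct G e-uw (sym w≡u)) w≢v)
              (si' u w e')

    in-G : ∣ suc (deg G' u) - deg G w ∣ ≡ 1
    in-G = subst (λ d → ∣ d - deg G w ∣ ≡ 1) endpoint-degree (si u w e-uw)

  endpoint-leaf : StepwiseIrregular G → StepwiseIrregular G' → deg G u ≡ 1
  endpoint-leaf si si' = trans endpoint-degree (cong suc (endpoint-isolated si si'))

mainTheorem12 : ∀ {n : ℕ} (G : Graph n) → Connected G → StepwiseIrregular G →
    ∀ (u v : Fin n) → Edge G u v → ¬ StepwiseIrregular (deleteEdge G u v)
mainTheorem12 G _ si u v e si' = 0≢1 (begin
  0                        ≡⟨ sym (∣n-n∣≡0 1) ⟩
  ∣ 1 - 1 ∣                ≡⟨ cong₂ ∣_-_∣ (sym u-leaf) (sym v-leaf) ⟩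
  ∣ deg G u - deg G v ∣    ≡⟨ si u v e ⟩
  1                        ∎)
  where
  0≢1 : 0 ≢ 1
  0≢1 ()

  u-leaf : deg G u ≡ 1
  u-leaf = DeleteEdge.endpoint-leaf G e si si'

  v-leaf : deg G v ≡ 1
  v-leaf = DeleteEdge.endpoint-leaf G (edge-sym G e) si
             (si-cong (deleteEdge G u v) (deleteEdge G v u) (deleteEdge-comm G u v) si')
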